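{- Let $n\ge 2$ and let $k,l,i,j\ge 0$. The number of plane trees with $n$ edges, $k$ singleton leaves, $l$ elder leaves, $i$ young leaves and $j$ young interior vertices equals the number of plane trees with $n$ edges, $l$ singleton leaves, $k$ elder leaves, $j$ young leaves and $i$ young interior vertices.
   Context: A plane tree is an unlabeled rooted tree in which the children of every vertex are linearly ordered from left to right. A leaf is a vertex with no children; an interior vertex is a vertex with at least one child. A leaf without any siblings is a singleton leaf. A leaf with siblings is an elder leaf if it is the leftmost child of its parent, and a young leaf otherwise. An interior vertex is a young interior vertex if it is not the parent of a singleton leaf or of an elder leaf. -}

module Defs where

open import Data.Nat using (ℕ; zero; suc; _+_)
open import Data.List using (List; []; _∷_)
open import Relation.Binary.PropositionalEquality using (_≡_)

data PlaneTree : Set where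
  node : List PlaneTree → PlaneTree

mutual
  edges : PlaneTree → ℕ
  edges (node ts) = edgesF ts

  edgesF : List PlaneTree → ℕ
  edgesF [] = 0
  edgesF (t ∷ ts) = suc (edges t + edgesF ts)

-- singleton leaves: leaves without siblings
mutual
  singletonLeaves : PlaneTree → ℕ
  singletonLeaves (node []) = 0
  singletonLeaves (node (node [] ∷ [])) = 1
  singletonLeaves (node ts) = singletonLeavesF ts

  singletonLeavesF : List PlaneTree → ℕ
  singletonLeavesF [] = 0
  singletonLeavesF (t ∷ ts) = singletonLeaves t + singletonLeavesF ts

-- elder leaves: leaves with siblings that are the leftmost child of their parent
mutual
  elderLeaves : PlaneTree → ℕ
  elderLeaves (node []) = 0
  elderLeaves (node (node [] ∷ (t ∷ ts))) = suc (elderLeavesF (node [] ∷ t ∷ ts))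
  elderLeaves (node ts) = elderLeavesF ts

  elderLeavesF : List PlaneTree → ℕ
  elderLeavesF [] = 0
  elderLeavesF (t ∷ ts) = elderLeaves t + elderLeavesF ts

leafCount : List PlaneTree → ℕ
leafCount [] = 0
leafCount (node [] ∷ ts) = suc (leafCount ts)
leafCount (node (_ ∷ _) ∷ ts) = leafCount ts

-- young leaves: leaves with siblings that are not the leftmost child
-- (i.e. leaves among the non-first children)
mutual
  youngLeaves : PlaneTree → ℕ
  youngLeaves (node []) = 0
  youngLeaves (node (t ∷ ts)) = leafCount ts + youngLeavesF (t ∷ ts)

  youngLeavesF : List PlaneTree → ℕ
  youngLeavesF [] = 0
  youngLeavesF (t ∷ ts) = youngLeaves t + youngLeavesF ts

-- young interior vertices: interior vertices that are not the parent of a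
-- singleton leaf or of an elder leaf, i.e. whose leftmost child is not a leaf
mutual
  youngInterior : PlaneTree → ℕ
  youngInterior (node []) = 0
  youngInterior (node (node [] ∷ ts)) = youngInteriorF (node [] ∷ ts)
  youngInterior (node (node (u ∷ us) ∷ ts)) = suc (youngInteriorF (node (u ∷ us) ∷ ts))

  youngInteriorF : List PlaneTree → ℕ
  youngInteriorF [] = 0
  youngInteriorF (t ∷ ts) = youngInterior t + youngInteriorF ts

record TreesWith (n k l i j : ℕ) : Set where
  constructor tw
  field
    tree       : PlaneTree
    hasEdges   : edges tree ≡ n
    hasSingle  : singletonLeaves tree ≡ k
    hasElder   : elderLeaves tree ≡ l
    hasYoung   : youngLeaves tree ≡ i
    hasYoungIn : youngInterior tree ≡ j

-- Encode a plane forest as a binary tree: p ▷ s is the forest p followed by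
-- one more tree, whose subtrees form the forest s.  Charge every statistic to a
-- single non-root vertex v: a singleton leaf to its parent, an elder leaf to the
-- next sibling, a young leaf to itself and a young interior vertex to its first
-- child.  If v is the root of the last tree of p ▷ s, its charge depends only on
-- the numbers m and n of edges in p and s: a singleton leaf if n = 1, an elder
-- leaf if m = 1, a young leaf if m > 0 = n and a young interior vertex if
-- m = 0 < n.  Exchanging m and n exchanges singleton with elder leaves and young
-- leaves with young interior vertices, so mirroring the binary tree (exchanging
-- p and s everywhere) swaps the statistics.  The root is never charged, which
-- matters only for the one-edge tree: its root is the parent of a singleton leaf.
module Submission where

open import Defs
open import Data.Bool using (Bool; true; false; _∧_)
open import Data.Bool.Properties using (∧-comm)
open import Data.Nat using (ℕ; suc; _+_; _≤_; s≤s; _≡ᵇ_; _<ᵇ_)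
open import Data.Nat.Properties using (+-comm; +-assoc; +-identityʳ; +-commutativeSemigroup; ≡-irrelevant)
open import Algebra.Properties.CommutativeSemigroup +-commutativeSemigroup using (interchange; x∙yz≈z∙yx)
open import Data.List using (List; []; _∷_; _∷ʳ_)
open import Function using (_∘_)
open import Function.Bundles using (_↔_; mk↔ₛ′)
open import Relation.Binary.PropositionalEquality using (_≡_; refl; sym; trans; cong; cong₂; subst; module ≡-Reasoning)

open ≡-Reasoning

record Stats : Set where
  constructor ⟨_,_,_,_,_⟩
  field
    n k l i j : ℕ

infixl 6 _⊕_

_⊕_ : Stats → Stats → Stats
⟨ n , k , l , i , j ⟩ ⊕ ⟨ n′ , k′ , l′ , i′ , j′ ⟩ = ⟨ n + n′ , k + k′ , l + l′ , i + i′ , j + j′ ⟩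

swap : Stats → Stats
swap ⟨ n , k , l , i , j ⟩ = ⟨ n , l , k , j , i ⟩

⟨⟩-cong : ∀ {n k l i j n′ k′ l′ i′ j′} → n ≡ n′ → k ≡ k′ → l ≡ l′ → i ≡ i′ → j ≡ j′ →
          ⟨ n , k , l , i , j ⟩ ≡ ⟨ n′ , k′ , l′ , i′ , j′ ⟩
⟨⟩-cong refl refl refl refl refl = refl

x⊕[y⊕z]≡z⊕[y⊕x] : ∀ x y z → x ⊕ (y ⊕ z) ≡ z ⊕ (y ⊕ x)
x⊕[y⊕z]≡z⊕[y⊕x] ⟨ n , k , l , i , j ⟩ ⟨ n′ , k′ , l′ , i′ , j′ ⟩ ⟨ n″ , k″ , l″ , i″ , j″ ⟩ =
  ⟨⟩-cong (x∙yz≈z∙yx n n′ n″) (x∙yz≈z∙yx k k′ k″) (x∙yz≈z∙yx l l′ l″) (x∙yz≈z∙yx i i′ i″) (x∙yz≈z∙yx j j′ j″)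

statsOf : PlaneTree → Stats
statsOf t = ⟨ edges t , singletonLeaves t , elderLeaves t , youngLeaves t , youngInterior t ⟩

[_] : Bool → ℕ
[ true ] = 1
[ false ] = 0

vertexStats : ℕ → ℕ → Stats
vertexStats m n = ⟨ 1 , [ n ≡ᵇ 1 ] , [ m ≡ᵇ 1 ] , [ (0 <ᵇ m) ∧ (n ≡ᵇ 0) ] , [ (m ≡ᵇ 0) ∧ (0 <ᵇ n) ] ⟩

vertexStats-swap : ∀ m n → vertexStats n m ≡ swap (vertexStats m n)
vertexStats-swap m n =
  cong₂ (λ a b → ⟨ 1 , [ m ≡ᵇ 1 ] , [ n ≡ᵇ 1 ] , [ a ] , [ b ] ⟩) (∧-comm (0 <ᵇ n) _) (∧-comm (n ≡ᵇ 0) _)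

infixl 5 _▷ˢ_

_▷ˢ_ : Stats → Stats → Stats
a ▷ˢ b = a ⊕ (vertexStats (Stats.n a) (Stats.n b) ⊕ b)

▷ˢ-swap : ∀ a b → swap b ▷ˢ swap a ≡ swap (a ▷ˢ b)
▷ˢ-swap a b = begin
  swap b ⊕ (vertexStats (Stats.n b) (Stats.n a) ⊕ swap a)
    ≡⟨ cong (λ v → swap b ⊕ (v ⊕ swap a)) (vertexStats-swap (Stats.n a) (Stats.n b)) ⟩
  swap b ⊕ (swap (vertexStats (Stats.n a) (Stats.n b)) ⊕ swap a)
    ≡⟨ x⊕[y⊕z]≡z⊕[y⊕x] (swap b) _ (swap a) ⟩
  swap (a ▷ˢ b) ∎

∷ʳ-additive : ∀ {A : Set} (f : A → ℕ) (F : List A → ℕ) → (∀ x xs → F (x ∷ xs) ≡ f x + F xs) →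
              ∀ xs y → F (xs ∷ʳ y) ≡ F xs + f y
∷ʳ-additive f F F-∷ [] y = trans (F-∷ y []) (+-comm (f y) (F []))
∷ʳ-additive f F F-∷ (x ∷ xs) y = begin
  F (x ∷ (xs ∷ʳ y))     ≡⟨ F-∷ x (xs ∷ʳ y) ⟩
  f x + F (xs ∷ʳ y)     ≡⟨ cong (f x +_) (∷ʳ-additive f F F-∷ xs y) ⟩
  f x + (F xs + f y)    ≡⟨ sym (+-assoc (f x) (F xs) (f y)) ⟩
  (f x + F xs) + f y    ≡⟨ cong (_+ f y) (sym (F-∷ x xs)) ⟩
  F (x ∷ xs) + f y      ∎

edgesF-∷ʳ : ∀ xs y → edgesF (xs ∷ʳ y) ≡ edgesF xs + suc (edges y)
edgesF-∷ʳ = ∷ʳ-additive (suc ∘ edges) edgesF (λ _ _ → refl)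

singletonLeavesF-∷ʳ : ∀ xs y → singletonLeavesF (xs ∷ʳ y) ≡ singletonLeavesF xs + singletonLeaves y
singletonLeavesF-∷ʳ = ∷ʳ-additive singletonLeaves singletonLeavesF (λ _ _ → refl)

elderLeavesF-∷ʳ : ∀ xs y → elderLeavesF (xs ∷ʳ y) ≡ elderLeavesF xs + elderLeaves y
elderLeavesF-∷ʳ = ∷ʳ-additive elderLeaves elderLeavesF (λ _ _ → refl)

youngLeavesF-∷ʳ : ∀ xs y → youngLeavesF (xs ∷ʳ y) ≡ youngLeavesF xs + youngLeaves y
youngLeavesF-∷ʳ = ∷ʳ-additive youngLeaves youngLeavesF (λ _ _ → refl)

youngInteriorF-∷ʳ : ∀ xs y → youngInteriorF (xs ∷ʳ y) ≡ youngInteriorF xs + youngInterior y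
youngInteriorF-∷ʳ = ∷ʳ-additive youngInterior youngInteriorF (λ _ _ → refl)

leafCount-∷ʳ : ∀ xs y → leafCount (xs ∷ʳ y) ≡ leafCount xs + [ edges y ≡ᵇ 0 ]
leafCount-∷ʳ = ∷ʳ-additive (λ t → [ edges t ≡ᵇ 0 ]) leafCount leafCount-∷
  where
  leafCount-∷ : ∀ t ts → leafCount (t ∷ ts) ≡ [ edges t ≡ᵇ 0 ] + leafCount ts
  leafCount-∷ (node []) ts = refl
  leafCount-∷ (node (_ ∷ _)) ts = refl

singletonLeaves-node : ∀ ts → singletonLeaves (node ts) ≡ [ edgesF ts ≡ᵇ 1 ] + singletonLeavesF ts
singletonLeaves-node [] = refl
singletonLeaves-node (node [] ∷ []) = refl
singletonLeaves-node (node [] ∷ _ ∷ _) = refl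
singletonLeaves-node (node (_ ∷ _) ∷ _) = refl

elderLeaves-∷ʳ : ∀ xs y →
  elderLeaves (node (xs ∷ʳ y)) ≡ elderLeaves (node xs) + ([ edgesF xs ≡ᵇ 1 ] + elderLeaves y)
elderLeaves-∷ʳ [] (node []) = refl
elderLeaves-∷ʳ [] y@(node (_ ∷ _)) = +-identityʳ (elderLeaves y)
elderLeaves-∷ʳ (node [] ∷ []) y = cong suc (+-identityʳ (elderLeaves y))
elderLeaves-∷ʳ xs@(node [] ∷ _ ∷ _) y = cong suc (elderLeavesF-∷ʳ xs y)
elderLeaves-∷ʳ xs@(node (_ ∷ _) ∷ _) y = elderLeavesF-∷ʳ xs y

youngLeaves-∷ʳ : ∀ xs y →
  youngLeaves (node (xs ∷ʳ y)) ≡ youngLeaves (node xs) + ([ (0 <ᵇ edgesF xs) ∧ (edges y ≡ᵇ 0) ] + youngLeaves y)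
youngLeaves-∷ʳ [] y = +-identityʳ (youngLeaves y)
youngLeaves-∷ʳ (x ∷ xs) y =
  trans (cong₂ _+_ (leafCount-∷ʳ xs y) (youngLeavesF-∷ʳ (x ∷ xs) y))
        (interchange (leafCount xs) _ (youngLeavesF (x ∷ xs)) _)

youngInterior-∷ʳ : ∀ xs y →
  youngInterior (node (xs ∷ʳ y)) ≡ youngInterior (node xs) + ([ (edgesF xs ≡ᵇ 0) ∧ (0 <ᵇ edges y) ] + youngInterior y)
youngInterior-∷ʳ [] (node []) = refl
youngInterior-∷ʳ [] y@(node (_ ∷ _)) = cong suc (+-identityʳ (youngInterior y))
youngInterior-∷ʳ xs@(node [] ∷ _) y = youngInteriorF-∷ʳ xs y
youngInterior-∷ʳ xs@(node (_ ∷ _) ∷ _) y = cong suc (youngInteriorF-∷ʳ xs y)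

-- A singleton leaf child of the root is not counted: it is the one charge not
-- made to a vertex of the forest ts.
forestStats : List PlaneTree → Stats
forestStats ts = ⟨ edgesF ts , singletonLeavesF ts , elderLeaves (node ts) , youngLeaves (node ts) , youngInterior (node ts) ⟩

forestStats-∷ʳ : ∀ xs ys → forestStats (xs ∷ʳ node ys) ≡ forestStats xs ▷ˢ forestStats ys
forestStats-∷ʳ xs ys = ⟨⟩-cong
  (edgesF-∷ʳ xs y)
  (trans (singletonLeavesF-∷ʳ xs y) (cong (singletonLeavesF xs +_) (singletonLeaves-node ys)))
  (elderLeaves-∷ʳ xs y)
  (youngLeaves-∷ʳ xs y)
  (youngInterior-∷ʳ xs y)
  where y = node ys

statsOf≡forestStats : ∀ ts → 2 ≤ edgesF ts → statsOf (node ts) ≡ forestStats ts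
statsOf≡forestStats [] ()
statsOf≡forestStats (node [] ∷ []) (s≤s ())
statsOf≡forestStats (node [] ∷ _ ∷ _) _ = refl
statsOf≡forestStats (node (_ ∷ _) ∷ _) _ = refl

infixl 5 _▷_

data Forest : Set where
  ε   : Forest
  _▷_ : Forest → Forest → Forest

toList : Forest → List PlaneTree
toList ε = []
toList (p ▷ s) = toList p ∷ʳ node (toList s)

_◁_ : Forest → Forest → Forest
u ◁ ε = ε ▷ u
u ◁ (p ▷ s) = (u ◁ p) ▷ s

fromList : List PlaneTree → Forest
fromList [] = ε
fromList (node us ∷ ts) = fromList us ◁ fromList ts

toList-◁ : ∀ u w → toList (u ◁ w) ≡ node (toList u) ∷ toList w
toList-◁ u ε = refl
toList-◁ u (p ▷ s) = cong (_∷ʳ node (toList s)) (toList-◁ u p)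

toList-fromList : ∀ ts → toList (fromList ts) ≡ ts
toList-fromList [] = refl
toList-fromList (node us ∷ ts) =
  trans (toList-◁ (fromList us) (fromList ts))
        (cong₂ (λ vs ws → node vs ∷ ws) (toList-fromList us) (toList-fromList ts))

fromList-∷ʳ : ∀ ts us → fromList (ts ∷ʳ node us) ≡ fromList ts ▷ fromList us
fromList-∷ʳ [] us = refl
fromList-∷ʳ (node vs ∷ ts) us = cong (fromList vs ◁_) (fromList-∷ʳ ts us)

fromList-toList : ∀ w → fromList (toList w) ≡ w
fromList-toList ε = refl
fromList-toList (p ▷ s) =
  trans (fromList-∷ʳ (toList p) (toList s)) (cong₂ _▷_ (fromList-toList p) (fromList-toList s))

mirror : Forest → Forest
mirror ε = ε
mirror (p ▷ s) = mirror s ▷ mirror p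

mirror-involutive : ∀ w → mirror (mirror w) ≡ w
mirror-involutive ε = refl
mirror-involutive (p ▷ s) = cong₂ _▷_ (mirror-involutive p) (mirror-involutive s)

forestStats-mirror : ∀ w → forestStats (toList (mirror w)) ≡ swap (forestStats (toList w))
forestStats-mirror ε = refl
forestStats-mirror (p ▷ s) = begin
  forestStats (toList (mirror s) ∷ʳ node (toList (mirror p)))
    ≡⟨ forestStats-∷ʳ (toList (mirror s)) (toList (mirror p)) ⟩
  forestStats (toList (mirror s)) ▷ˢ forestStats (toList (mirror p))
    ≡⟨ cong₂ _▷ˢ_ (forestStats-mirror s) (forestStats-mirror p) ⟩
  swap (forestStats (toList s)) ▷ˢ swap (forestStats (toList p))
    ≡⟨ ▷ˢ-swap (forestStats (toList p)) (forestStats (toList s)) ⟩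
  swap (forestStats (toList p) ▷ˢ forestStats (toList s))
    ≡⟨ cong swap (sym (forestStats-∷ʳ (toList p) (toList s))) ⟩
  swap (forestStats (toList (p ▷ s))) ∎

φ : PlaneTree → PlaneTree
φ (node ts) = node (toList (mirror (fromList ts)))

φ-involutive : ∀ t → φ (φ t) ≡ t
φ-involutive (node ts) = cong node (begin
  toList (mirror (fromList (toList (mirror (fromList ts)))))
    ≡⟨ cong (toList ∘ mirror) (fromList-toList (mirror (fromList ts))) ⟩
  toList (mirror (mirror (fromList ts)))
    ≡⟨ cong toList (mirror-involutive (fromList ts)) ⟩
  toList (fromList ts)
    ≡⟨ toList-fromList ts ⟩
  ts ∎)

statsOf-φ : ∀ t → 2 ≤ edges t → statsOf (φ t) ≡ swap (statsOf t)
statsOf-φ (node ts) 2≤e = begin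
  statsOf (node ts′)            ≡⟨ statsOf≡forestStats ts′ (subst (2 ≤_) (sym (cong Stats.n swapped)) 2≤e) ⟩
  forestStats ts′               ≡⟨ swapped ⟩
  swap (forestStats ts)         ≡⟨ cong swap (sym (statsOf≡forestStats ts 2≤e)) ⟩
  swap (statsOf (node ts))      ∎
  where
  ts′ = toList (mirror (fromList ts))
  swapped : forestStats ts′ ≡ swap (forestStats ts)
  swapped = trans (forestStats-mirror (fromList ts)) (cong (swap ∘ forestStats) (toList-fromList ts))

TreesWith-≡ : ∀ {n k l i j} {a b : TreesWith n k l i j} → TreesWith.tree a ≡ TreesWith.tree b → a ≡ b
TreesWith-≡ {a = tw t e₁ s₁ l₁ y₁ j₁} {b = tw .t e₂ s₂ l₂ y₂ j₂} refl
  rewrite ≡-irrelevant e₁ e₂ | ≡-irrelevant s₁ s₂ | ≡-irrelevant l₁ l₂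
        | ≡-irrelevant y₁ y₂ | ≡-irrelevant j₁ j₂ = refl

φ-TreesWith : ∀ {n k l i j} → 2 ≤ n → TreesWith n k l i j → TreesWith n l k j i
φ-TreesWith 2≤n (tw t #n #k #l #i #j) =
  tw (φ t) (cong Stats.n eq) (cong Stats.k eq) (cong Stats.l eq) (cong Stats.i eq) (cong Stats.j eq)
  where
  eq = trans (statsOf-φ t (subst (2 ≤_) (sym #n) 2≤n)) (cong swap (⟨⟩-cong #n #k #l #i #j))

φ-TreesWith-involutive : ∀ {n k l i j} (2≤n : 2 ≤ n) (x : TreesWith n k l i j) →
                         φ-TreesWith 2≤n (φ-TreesWith 2≤n x) ≡ x
φ-TreesWith-involutive 2≤n x = TreesWith-≡ (φ-involutive (TreesWith.tree x))

proposition1p9 : (n k l i j : ℕ) → 2 ≤ n →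
    TreesWith n k l i j ↔ TreesWith n l k j i
proposition1p9 n k l i j 2≤n =
  mk↔ₛ′ (φ-TreesWith 2≤n) (φ-TreesWith 2≤n) (φ-TreesWith-involutive 2≤n) (φ-TreesWith-involutive 2≤n)
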